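{- Let $\Gamma$ be the directed graph whose vertices are the pairs $(n,k)$ with integers $n\ge k\ge 0$, and whose edges are, for every $n\ge k\ge 0$, an edge from $(n+1,k)$ to $(n+1,k+1)$ and an edge from $(n,n-k)$ to $(n+1,k+1)$. For $0\le i\le n$ and $0\le k\le n$, let $\pi(n,k,i)$ be the number of directed paths in $\Gamma$ from vertex $(i,0)$ to vertex $(n,k)$ (a path of length zero counting when the vertices coincide). Then for $n\ge2$, $0<k<n$, $0<i\le n$, $$\pi(n,k,i)=\sum_{s=0}^{\min\{k,\,n-i\}}\binom{k}{s}\binom{n-k}{n-i-s}\,\pi(n-i,s,0).$$ -}

module Defs where

open import Data.Nat using (ℕ; zero; suc; _∸_; _≤_)
open import Data.Product using (_×_; _,_)

-- Vertices of Γ: pairs (n , k); only pairs with k ≤ n occur as endpoints of edges.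
Vertex : Set
Vertex = ℕ × ℕ

data Edge : Vertex → Vertex → Set where
  horiz : ∀ {n k} → k ≤ n → Edge (suc n , k) (suc n , suc k)
  diag  : ∀ {n k} → k ≤ n → Edge (n , n ∸ k) (suc n , suc k)

data Path : Vertex → Vertex → Set where
  here : ∀ {v} → Path v v
  _∷_  : ∀ {u v w} → Edge u v → Path v w → Path u w

{-# OPTIONS --safe #-}
module Submission where

-- Counting paths by their last edge gives π(n+1,k+1,i) = π(n+1,k,i) + π(n,n−k,i), with
-- boundary values π(n,0,i) = [n = i] and π(i,k,i) = 1.  The right-hand side is the weighted
-- Vandermonde sum V(k, n−k, n−i; E) with V(a,b,M; E) = Σ_{s+t=M} C(a,s) C(b,t) E(s) and
-- E = π(n−i,·,0).  Pascal's rule in both binomials, together with the case i = 0 of the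
-- recurrence, E(s+1) = E(s) + E′(t) for s + t = M − 1 where E′ = π(M−1,·,0), shows
--   V(a+1, b, M; E) = V(a, b+1, M; E) + V(b, a, M−1; E′),
-- which is the same recurrence, so induction on (n − i, k) proves the formula.

open import Defs
open import Data.Nat using (ℕ; zero; suc; _+_; _*_; _∸_; _≤_; _<_; _⊓_; z≤n; s≤s)
open import Data.Nat.Properties
open import Data.Nat.Combinatorics using (_C_; k>n⇒nCk≡0; nCk+nC[k+1]≡[n+1]C[k+1])
open import Data.Nat.ListAction using (sum)
open import Data.List using (map; upTo; applyUpTo)
open import Data.List.Properties using (map-upTo)
open import Data.Product using (_,_)
open import Data.Sum using (_⊎_; inj₁; inj₂)
open import Data.Sum.Function.Propositional using (_⊎-↔_)
open import Data.Empty using (⊥-elim)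
open import Data.Fin using (Fin)
open import Data.Fin.Properties using (+↔⊎)
open import Data.Fin.Permutation using (↔⇒≡)
open import Function.Bundles using (_↔_; mk↔ₛ′)
open import Function.Properties.Inverse using (↔-trans; ↔-sym)
open import Relation.Nullary using (¬_)
open import Relation.Binary.PropositionalEquality
  using (_≡_; refl; sym; trans; cong; cong₂; subst; module ≡-Reasoning)
open import Algebra.Properties.CommutativeSemigroup +-commutativeSemigroup
  using (interchange; x∙yz≈xz∙y)
open import Algebra.Properties.CommutativeSemigroup *-commutativeSemigroup
  using (xy∙z≈y∙xz)

∑ : ℕ → (ℕ → ℕ → ℕ) → ℕ
∑ zero    F = F 0 0
∑ (suc M) F = F 0 (suc M) + ∑ M (λ s t → F (suc s) t)

infix 6.6 ∑
syntax ∑ M (λ s t → e) = ∑[ s + t ≡ M ] e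

∑-cong : ∀ M {F G : ℕ → ℕ → ℕ} → (∀ s t → s + t ≡ M → F s t ≡ G s t) → ∑ M F ≡ ∑ M G
∑-cong zero    F≡G = F≡G 0 0 refl
∑-cong (suc M) F≡G =
  cong₂ _+_ (F≡G 0 (suc M) refl) (∑-cong M (λ s t eq → F≡G (suc s) t (cong suc eq)))

∑-vanishing : ∀ M {F : ℕ → ℕ → ℕ} → (∀ s t → s + t ≡ M → F s t ≡ 0) → ∑ M F ≡ 0
∑-vanishing zero    F≡0 = F≡0 0 0 refl
∑-vanishing (suc M) F≡0 =
  cong₂ _+_ (F≡0 0 (suc M) refl) (∑-vanishing M (λ s t eq → F≡0 (suc s) t (cong suc eq)))

∑-distrib-+ : ∀ M (F G : ℕ → ℕ → ℕ) → ∑[ s + t ≡ M ] (F s t + G s t) ≡ ∑ M F + ∑ M G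
∑-distrib-+ zero    F G = refl
∑-distrib-+ (suc M) F G =
  trans (cong (F 0 (suc M) + G 0 (suc M) +_) (∑-distrib-+ M (λ s t → F (suc s) t) (λ s t → G (suc s) t)))
        (interchange (F 0 (suc M)) (G 0 (suc M)) _ _)

∑-last : ∀ M (F : ℕ → ℕ → ℕ) → ∑ (suc M) F ≡ ∑[ s + t ≡ M ] F s (suc t) + F (suc M) 0
∑-last zero    F = refl
∑-last (suc M) F =
  trans (cong (F 0 (suc (suc M)) +_) (∑-last M (λ s t → F (suc s) t)))
        (sym (+-assoc (F 0 (suc (suc M))) _ _))

∑-swap : ∀ M (F : ℕ → ℕ → ℕ) → ∑ M F ≡ ∑[ s + t ≡ M ] F t s
∑-swap zero    F = refl
∑-swap (suc M) F = begin
  F 0 (suc M) + ∑[ s + t ≡ M ] F (suc s) t ≡⟨ cong (F 0 (suc M) +_) (∑-swap M (λ s t → F (suc s) t)) ⟩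
  F 0 (suc M) + ∑[ s + t ≡ M ] F (suc t) s ≡⟨ +-comm (F 0 (suc M)) _ ⟩
  ∑[ s + t ≡ M ] F (suc t) s + F 0 (suc M) ≡⟨ sym (∑-last M (λ s t → F t s)) ⟩
  ∑[ s + t ≡ suc M ] F t s                 ∎
  where open ≡-Reasoning

∑-as-sum : ∀ M (F : ℕ → ℕ → ℕ) → ∑ M F ≡ sum (applyUpTo (λ s → F s (M ∸ s)) (suc M))
∑-as-sum zero    F = sym (+-identityʳ (F 0 0))
∑-as-sum (suc M) F = cong (F 0 (suc M) +_) (∑-as-sum M (λ s t → F (suc s) t))

sum-applyUpTo-vanishing : ∀ m (f : ℕ → ℕ) → (∀ s → f s ≡ 0) → sum (applyUpTo f m) ≡ 0
sum-applyUpTo-vanishing zero    f f≡0 = refl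
sum-applyUpTo-vanishing (suc m) f f≡0 =
  cong₂ _+_ (f≡0 0) (sum-applyUpTo-vanishing m (λ s → f (suc s)) (λ s → f≡0 (suc s)))

sum-applyUpTo-⊓ : ∀ k m (f : ℕ → ℕ) → (∀ s → k ≤ s → f s ≡ 0) →
                  sum (applyUpTo f (k ⊓ m)) ≡ sum (applyUpTo f m)
sum-applyUpTo-⊓ zero    m       f f≡0 = sym (sum-applyUpTo-vanishing m f (λ s → f≡0 s z≤n))
sum-applyUpTo-⊓ (suc k) zero    f f≡0 = refl
sum-applyUpTo-⊓ (suc k) (suc m) f f≡0 =
  cong (f 0 +_) (sum-applyUpTo-⊓ k m (λ s → f (suc s)) (λ s k≤s → f≡0 (suc s) (s≤s k≤s)))

∑-pascal : ∀ a M (F : ℕ → ℕ → ℕ) →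
  ∑[ s + t ≡ suc M ] (suc a C s) * F s t
  ≡ ∑[ s + t ≡ suc M ] (a C s) * F s t + ∑[ s + t ≡ M ] (a C s) * F (suc s) t
∑-pascal a M F = begin
  first + ∑[ s + t ≡ M ] (suc a C suc s) * F (suc s) t
    ≡⟨ cong (first +_) (∑-cong M (λ s t _ → pascal s (F (suc s) t))) ⟩
  first + ∑[ s + t ≡ M ] ((a C s) * F (suc s) t + (a C suc s) * F (suc s) t)
    ≡⟨ cong (first +_) (∑-distrib-+ M (λ s t → (a C s) * F (suc s) t)
                                       (λ s t → (a C suc s) * F (suc s) t)) ⟩
  first + (shifted + ∑[ s + t ≡ M ] (a C suc s) * F (suc s) t)
    ≡⟨ x∙yz≈xz∙y first shifted _ ⟩
  ∑[ s + t ≡ suc M ] (a C s) * F s t + shifted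
    ∎
  where
  open ≡-Reasoning
  first shifted : ℕ
  first   = (a C 0) * F 0 (suc M)
  shifted = ∑[ s + t ≡ M ] (a C s) * F (suc s) t
  pascal : ∀ s x → (suc a C suc s) * x ≡ (a C s) * x + (a C suc s) * x
  pascal s x = trans (cong (_* x) (sym (nCk+nC[k+1]≡[n+1]C[k+1] a s))) (*-distribʳ-+ x (a C s) (a C suc s))

vandermonde : ℕ → ℕ → ℕ → (ℕ → ℕ) → ℕ
vandermonde a b M E = ∑[ s + t ≡ M ] (a C s) * (b C t) * E s

vandermonde-swap : ∀ a b M (E : ℕ → ℕ) →
  vandermonde a b M E ≡ ∑[ s + t ≡ M ] (b C s) * ((a C t) * E t)
vandermonde-swap a b M E =
  trans (∑-swap M _) (∑-cong M (λ s t _ → xy∙z≈y∙xz (a C t) (b C s) (E t)))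

vandermonde-sucˡ : ∀ a b M (E : ℕ → ℕ) →
  vandermonde (suc a) b (suc M) E ≡ vandermonde a b (suc M) E + vandermonde a b M (λ s → E (suc s))
vandermonde-sucˡ a b M E = begin
  vandermonde (suc a) b (suc M) E
    ≡⟨ ∑-cong (suc M) (λ s t _ → *-assoc (suc a C s) (b C t) (E s)) ⟩
  ∑[ s + t ≡ suc M ] (suc a C s) * ((b C t) * E s)
    ≡⟨ ∑-pascal a M (λ s t → (b C t) * E s) ⟩
  ∑[ s + t ≡ suc M ] (a C s) * ((b C t) * E s) + ∑[ s + t ≡ M ] (a C s) * ((b C t) * E (suc s))
    ≡⟨ cong₂ _+_ (∑-cong (suc M) (λ s t _ → sym (*-assoc (a C s) (b C t) (E s))))
                 (∑-cong M (λ s t _ → sym (*-assoc (a C s) (b C t) (E (suc s))))) ⟩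
  vandermonde a b (suc M) E + vandermonde a b M (λ s → E (suc s))
    ∎
  where open ≡-Reasoning

vandermonde-sucʳ : ∀ a b M (E : ℕ → ℕ) →
  vandermonde a (suc b) (suc M) E ≡ vandermonde a b (suc M) E + vandermonde a b M E
vandermonde-sucʳ a b M E = begin
  vandermonde a (suc b) (suc M) E
    ≡⟨ vandermonde-swap a (suc b) (suc M) E ⟩
  ∑[ s + t ≡ suc M ] (suc b C s) * ((a C t) * E t)
    ≡⟨ ∑-pascal b M (λ s t → (a C t) * E t) ⟩
  ∑[ s + t ≡ suc M ] (b C s) * ((a C t) * E t) + ∑[ s + t ≡ M ] (b C s) * ((a C t) * E t)
    ≡⟨ sym (cong₂ _+_ (vandermonde-swap a b (suc M) E) (vandermonde-swap a b M E)) ⟩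
  vandermonde a b (suc M) E + vandermonde a b M E
    ∎
  where open ≡-Reasoning

vandermonde-shift : ∀ a b M (E E′ : ℕ → ℕ) → (∀ s t → s + t ≡ M → E (suc s) ≡ E s + E′ t) →
  vandermonde a b M (λ s → E (suc s)) ≡ vandermonde a b M E + vandermonde b a M E′
vandermonde-shift a b M E E′ E-step = begin
  vandermonde a b M (λ s → E (suc s))
    ≡⟨ ∑-cong M (λ s t eq → trans (cong (w s t *_) (E-step s t eq)) (*-distribˡ-+ (w s t) (E s) (E′ t))) ⟩
  ∑[ s + t ≡ M ] (w s t * E s + w s t * E′ t)
    ≡⟨ ∑-distrib-+ M (λ s t → w s t * E s) (λ s t → w s t * E′ t) ⟩
  vandermonde a b M E + ∑[ s + t ≡ M ] w s t * E′ t
    ≡⟨ cong (vandermonde a b M E +_) (∑-cong M (λ s t _ → *-assoc (a C s) (b C t) (E′ t))) ⟩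
  vandermonde a b M E + ∑[ s + t ≡ M ] (a C s) * ((b C t) * E′ t)
    ≡⟨ cong (vandermonde a b M E +_) (sym (vandermonde-swap b a M E′)) ⟩
  vandermonde a b M E + vandermonde b a M E′
    ∎
  where
  open ≡-Reasoning
  w : ℕ → ℕ → ℕ
  w s t = (a C s) * (b C t)

vandermonde-step : ∀ a b M (E E′ : ℕ → ℕ) → (∀ s t → s + t ≡ M → E (suc s) ≡ E s + E′ t) →
  vandermonde (suc a) b (suc M) E ≡ vandermonde a (suc b) (suc M) E + vandermonde b a M E′
vandermonde-step a b M E E′ E-step = begin
  vandermonde (suc a) b (suc M) E
    ≡⟨ vandermonde-sucˡ a b M E ⟩
  X + vandermonde a b M (λ s → E (suc s))
    ≡⟨ cong (X +_) (vandermonde-shift a b M E E′ E-step) ⟩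
  X + (Y + Z)
    ≡⟨ sym (+-assoc X Y Z) ⟩
  X + Y + Z
    ≡⟨ cong (_+ Z) (sym (vandermonde-sucʳ a b M E)) ⟩
  vandermonde a (suc b) (suc M) E + Z
    ∎
  where
  open ≡-Reasoning
  X Y Z : ℕ
  X = vandermonde a b (suc M) E
  Y = vandermonde a b M E
  Z = vandermonde b a M E′

data SnocPath (u : Vertex) : Vertex → Set where
  []   : SnocPath u u
  _∷ʳ_ : ∀ {v w} → SnocPath u v → Edge v w → SnocPath u w

appendToSnoc : ∀ {u v w} → SnocPath u v → Path v w → SnocPath u w
appendToSnoc r here    = r
appendToSnoc r (e ∷ p) = appendToSnoc (r ∷ʳ e) p

appendToPath : ∀ {u v w} → SnocPath u v → Path v w → Path u w
appendToPath []       p = p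
appendToPath (r ∷ʳ e) p = appendToPath r (e ∷ p)

appendToPath-appendToSnoc : ∀ {u v w} (r : SnocPath u v) (p : Path v w) →
  appendToPath (appendToSnoc r p) here ≡ appendToPath r p
appendToPath-appendToSnoc r here    = refl
appendToPath-appendToSnoc r (e ∷ p) = appendToPath-appendToSnoc (r ∷ʳ e) p

appendToSnoc-appendToPath : ∀ {u v w} (r : SnocPath u v) (p : Path v w) →
  appendToSnoc [] (appendToPath r p) ≡ appendToSnoc r p
appendToSnoc-appendToPath []       p = refl
appendToSnoc-appendToPath (r ∷ʳ e) p = appendToSnoc-appendToPath r (e ∷ p)

Path↔SnocPath : ∀ {u w} → Path u w ↔ SnocPath u w
Path↔SnocPath = mk↔ₛ′ (appendToSnoc []) (λ r → appendToPath r here)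
  (λ r → appendToSnoc-appendToPath r here) (appendToPath-appendToSnoc [])

last-edge : ∀ {i n k} → k ≤ n →
  SnocPath (i , 0) (suc n , suc k) ↔ (SnocPath (i , 0) (suc n , k) ⊎ SnocPath (i , 0) (n , n ∸ k))
last-edge {i} {n} {k} k≤n = mk↔ₛ′ split join (λ { (inj₁ r) → refl ; (inj₂ r) → refl }) join-split
  where
  split : SnocPath (i , 0) (suc n , suc k) → SnocPath (i , 0) (suc n , k) ⊎ SnocPath (i , 0) (n , n ∸ k)
  split (r ∷ʳ horiz _) = inj₁ r
  split (r ∷ʳ diag _)  = inj₂ r
  join : SnocPath (i , 0) (suc n , k) ⊎ SnocPath (i , 0) (n , n ∸ k) → SnocPath (i , 0) (suc n , suc k)
  join (inj₁ r) = r ∷ʳ horiz k≤n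
  join (inj₂ r) = r ∷ʳ diag k≤n
  join-split : ∀ r → join (split r) ≡ r
  join-split (r ∷ʳ horiz k≤n′) = cong (λ k≤n → r ∷ʳ horiz k≤n) (≤-irrelevant k≤n k≤n′)
  join-split (r ∷ʳ diag k≤n′)  = cong (λ k≤n → r ∷ʳ diag k≤n) (≤-irrelevant k≤n k≤n′)

SnocPath-row-monotone : ∀ {m j n k} → SnocPath (m , j) (n , k) → m ≤ n
SnocPath-row-monotone []              = ≤-refl
SnocPath-row-monotone (r ∷ʳ horiz _) = SnocPath-row-monotone r
SnocPath-row-monotone (r ∷ʳ diag _)  = m≤n⇒m≤1+n (SnocPath-row-monotone r)

SnocPath-column-zero : ∀ {i n} → SnocPath (i , 0) (n , 0) → i ≡ n
SnocPath-column-zero [] = refl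

SnocPath-self↔Fin1 : ∀ {i} → SnocPath (i , 0) (i , 0) ↔ Fin 1
SnocPath-self↔Fin1 = mk↔ₛ′ (λ _ → Fin.zero) (λ _ → [])
  (λ { Fin.zero → refl ; (Fin.suc ()) }) (λ { [] → refl ; (_ ∷ʳ ()) })

¬⇒↔Fin0 : ∀ {A : Set} → ¬ A → A ↔ Fin 0
¬⇒↔Fin0 ¬a = mk↔ₛ′ (λ a → ⊥-elim (¬a a)) (λ ()) (λ ()) (λ a → ⊥-elim (¬a a))

module PathCount (π : ℕ → ℕ → ℕ → ℕ)
                 (π-counts : ∀ n k i → i ≤ n → k ≤ n → Path (i , 0) (n , k) ↔ Fin (π n k i)) where

  snocPath-counts : ∀ {n k i} → i ≤ n → k ≤ n → SnocPath (i , 0) (n , k) ↔ Fin (π n k i)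
  snocPath-counts {n} {k} {i} i≤n k≤n = ↔-trans (↔-sym Path↔SnocPath) (π-counts n k i i≤n k≤n)

  ↔Fin⇒π≡ : ∀ {n k i c} → i ≤ n → k ≤ n → SnocPath (i , 0) (n , k) ↔ Fin c → π n k i ≡ c
  ↔Fin⇒π≡ i≤n k≤n r↔c = ↔⇒≡ (↔-trans (↔-sym (snocPath-counts i≤n k≤n)) r↔c)

  π-last-edge : ∀ {n k i c} → i ≤ suc n → k ≤ n → SnocPath (i , 0) (n , n ∸ k) ↔ Fin c →
                π (suc n) (suc k) i ≡ π (suc n) k i + c
  π-last-edge i≤1+n k≤n r↔c = ↔Fin⇒π≡ i≤1+n (s≤s k≤n)
    (↔-trans (last-edge k≤n)
      (↔-trans (snocPath-counts i≤1+n (m≤n⇒m≤1+n k≤n) ⊎-↔ r↔c) (↔-sym +↔⊎)))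

  π-step : ∀ {n k b i} → i ≤ n → k + b ≡ n → π (suc n) (suc k) i ≡ π (suc n) k i + π n b i
  π-step {k = k} {b} {i} i≤n refl = trans
    (π-last-edge (m≤n⇒m≤1+n i≤n) (m≤m+n k b)
      (snocPath-counts i≤n (m∸n≤m (k + b) k)))
    (cong (λ j → π (suc (k + b)) k i + π (k + b) j i) (m+n∸m≡n k b))

  π-top-row : ∀ {i k} → k ≤ i → π i k i ≡ 1
  π-top-row {k = zero} _ = ↔Fin⇒π≡ ≤-refl z≤n SnocPath-self↔Fin1
  π-top-row {suc n} {suc k} (s≤s k≤n) = begin
    π (suc n) (suc k) (suc n)
      ≡⟨ π-last-edge ≤-refl k≤n (¬⇒↔Fin0 (λ r → 1+n≰n (SnocPath-row-monotone r))) ⟩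
    π (suc n) k (suc n) + 0
      ≡⟨ +-identityʳ _ ⟩
    π (suc n) k (suc n)
      ≡⟨ π-top-row (m≤n⇒m≤1+n k≤n) ⟩
    1 ∎
    where open ≡-Reasoning

  π-column-zero : ∀ {n i} → i < n → π n 0 i ≡ 0
  π-column-zero i<n = ↔Fin⇒π≡ (<⇒≤ i<n) z≤n (¬⇒↔Fin0 (λ r → <⇒≢ i<n (SnocPath-column-zero r)))

  π-vandermonde : ∀ {i m k b} → k + b ≡ m + i → π (m + i) k i ≡ vandermonde k b m (λ s → π m s 0)
  π-vandermonde {i} {zero} {k} {b} k+b≡i = begin
    π i k i                ≡⟨ π-top-row (subst (k ≤_) k+b≡i (m≤m+n k b)) ⟩
    1                      ≡⟨ sym (π-top-row z≤n) ⟩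
    π 0 0 0                ≡⟨ sym (*-identityˡ (π 0 0 0)) ⟩
    1 * π 0 0 0            ∎
    where open ≡-Reasoning
  π-vandermonde {i} {suc m} {zero} {b} _ =
    trans (π-column-zero (s≤s (m≤n+m i m))) (sym (∑-vanishing (suc m) term≡0))
    where
    term≡0 : ∀ s t → s + t ≡ suc m → (0 C s) * (b C t) * π (suc m) s 0 ≡ 0
    term≡0 zero    t _ =
      trans (cong ((0 C 0) * (b C t) *_) (π-column-zero (s≤s z≤n))) (*-zeroʳ ((0 C 0) * (b C t)))
    term≡0 (suc s) t _ =
      cong (λ c → c * (b C t) * π (suc m) (suc s) 0) (k>n⇒nCk≡0 {0} {suc s} (s≤s z≤n))
  π-vandermonde {i} {suc m} {suc k} {b} k+b≡m+i = begin
    π (suc m + i) (suc k) i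
      ≡⟨ π-step (m≤n+m i m) (suc-injective k+b≡m+i) ⟩
    π (suc m + i) k i + π (m + i) b i
      ≡⟨ cong₂ _+_ (π-vandermonde (trans (+-suc k b) k+b≡m+i))
                   (π-vandermonde (trans (+-comm b k) (suc-injective k+b≡m+i))) ⟩
    vandermonde k (suc b) (suc m) (λ s → π (suc m) s 0) + vandermonde b k m (λ s → π m s 0)
      ≡⟨ sym (vandermonde-step k b m (λ s → π (suc m) s 0) (λ s → π m s 0)
                               (λ s t s+t≡m → π-step z≤n s+t≡m)) ⟩
    vandermonde (suc k) b (suc m) (λ s → π (suc m) s 0)
      ∎
    where open ≡-Reasoning

proposition4 : (π : ℕ → ℕ → ℕ → ℕ)
    → (∀ n k i → i ≤ n → k ≤ n → Path (i , 0) (n , k) ↔ Fin (π n k i))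
    → ∀ n k i → 2 ≤ n → 0 < k → k < n → 0 < i → i ≤ n
    → π n k i ≡ sum (map (λ s → (k C s) * ((n ∸ k) C ((n ∸ i) ∸ s)) * π (n ∸ i) s 0) (upTo (suc (k ⊓ (n ∸ i)))))
proposition4 π π-counts n k i _ _ k<n _ i≤n = begin
  π n k i
    ≡⟨ cong (λ n′ → π n′ k i) (sym (m∸n+n≡m i≤n)) ⟩
  π (n ∸ i + i) k i
    ≡⟨ π-vandermonde (trans (m+[n∸m]≡n (<⇒≤ k<n)) (sym (m∸n+n≡m i≤n))) ⟩
  vandermonde k (n ∸ k) (n ∸ i) (λ s → π (n ∸ i) s 0)
    ≡⟨ ∑-as-sum (n ∸ i) (λ s t → (k C s) * ((n ∸ k) C t) * π (n ∸ i) s 0) ⟩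
  sum (applyUpTo term (suc (n ∸ i)))
    ≡⟨ sym (sum-applyUpTo-⊓ (suc k) (suc (n ∸ i)) term term-vanishing) ⟩
  sum (applyUpTo term (suc (k ⊓ (n ∸ i))))
    ≡⟨ cong sum (sym (map-upTo term (suc (k ⊓ (n ∸ i))))) ⟩
  sum (map term (upTo (suc (k ⊓ (n ∸ i)))))
    ∎
  where
  open ≡-Reasoning
  open PathCount π π-counts
  term : ℕ → ℕ
  term s = (k C s) * ((n ∸ k) C ((n ∸ i) ∸ s)) * π (n ∸ i) s 0
  term-vanishing : ∀ s → k < s → term s ≡ 0
  term-vanishing s k<s = cong (λ c → c * ((n ∸ k) C ((n ∸ i) ∸ s)) * π (n ∸ i) s 0) (k>n⇒nCk≡0 k<s)
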